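{- Every nonzero subTuring degree bounds a quasiminimal subTuring degree: for every partial function $f\colon\subseteq\omega\to\omega$ that has no partial computable extension, there is a quasiminimal partial function $h$ with $h\leq_{\rm subT} f$.
   Context: For a partial computable function $\Phi$ from finite sequences of natural numbers to $\{0,1\}\times\omega$ and a partial function $g\colon\subseteq\omega\to\omega$, the $g$-relative sequential computation $\Phi[g]$ is defined as follows. On input $n$, with oracle answers $a_0,\dots,a_{s-1}$ obtained so far: if $\Phi(n,a_0,\dots,a_{s-1})$ is undefined, $\Phi[g](n)$ is undefined; if it equals $\langle 1,q\rangle$ the computation halts with output $q$; if it equals $\langle 0,q\rangle$, $q$ is a query, and if $q\in{\rm dom}(g)$ the computation continues with $a_s=g(q)$, while if $q\notin{\rm dom}(g)$ the computation never halts. For partial $f,g$, $f\leq_{\rm subT} g$ means there is such $\Phi$ with $f\subseteq\Phi[g]$. A partial function is computable (of subTuring degree zero) iff it has a partial computable extension. A partial function $f$ is quasiminimal if $f$ is non-computable but every total function $g\leq_{\rm subT} f$ is computable. -}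

module Defs where

open import Data.Nat using (ℕ; zero; suc; _+_; _*_; _^_; _<_)
open import Data.Fin using (Fin)
open import Data.Vec using (Vec; []; _∷_; lookup)
open import Data.List using (List; []; _∷_; _++_; [_])
open import Data.Product using (Σ; ∃; _×_; _,_)
open import Relation.Binary.PropositionalEquality using (_≡_)
open import Relation.Nullary using (¬_)

data PR : ℕ → Set where
  zer  : ∀ {n} → PR n
  succ : PR 1
  proj : ∀ {n} → Fin n → PR n
  comp : ∀ {m n} → PR m → Vec (PR n) m → PR n
  prim : ∀ {n} → PR n → PR (suc (suc n)) → PR (suc n)
  mu   : ∀ {n} → PR (suc n) → PR n

mutual
  data _[_]⇓_ : ∀ {n} → PR n → Vec ℕ n → ℕ → Set where
    ev-zer  : ∀ {n} {xs : Vec ℕ n} → zer [ xs ]⇓ 0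
    ev-succ : ∀ {x} → succ [ x ∷ [] ]⇓ suc x
    ev-proj : ∀ {n} {i : Fin n} {xs} → proj i [ xs ]⇓ lookup xs i
    ev-comp : ∀ {m n} {f : PR m} {gs : Vec (PR n) m} {xs ys y} →
              gs [ xs ]⇓* ys → f [ ys ]⇓ y → comp f gs [ xs ]⇓ y
    ev-prim-z : ∀ {n} {g : PR n} {h xs y} →
              g [ xs ]⇓ y → prim g h [ 0 ∷ xs ]⇓ y
    ev-prim-s : ∀ {n} {g : PR n} {h k xs y z} →
              prim g h [ k ∷ xs ]⇓ y → h [ k ∷ y ∷ xs ]⇓ z →
              prim g h [ suc k ∷ xs ]⇓ z
    ev-mu   : ∀ {n} {f : PR (suc n)} {xs y} →
              f [ y ∷ xs ]⇓ 0 →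
              (∀ i → i < y → ∃ λ k → f [ i ∷ xs ]⇓ suc k) →
              mu f [ xs ]⇓ y

  data _[_]⇓*_ : ∀ {m n} → Vec (PR n) m → Vec ℕ n → Vec ℕ m → Set where
    ev-[] : ∀ {n} {xs : Vec ℕ n} → [] [ xs ]⇓* []
    ev-∷  : ∀ {m n} {g : PR n} {gs : Vec (PR n) m} {xs y ys} →
            g [ xs ]⇓ y → gs [ xs ]⇓* ys → (g ∷ gs) [ xs ]⇓* (y ∷ ys)

record PartialFn : Set₁ where
  field
    graph      : ℕ → ℕ → Set
    functional : ∀ {n y y′} → graph n y → graph n y′ → y ≡ y′
open PartialFn public

total : (ℕ → ℕ) → PartialFn
total g = record { graph = λ n y → g n ≡ y
                 ; functional = λ { _≡_.refl _≡_.refl → _≡_.refl } }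

_⊆ₚ_ : PartialFn → (ℕ → ℕ → Set) → Set
f ⊆ₚ R = ∀ n y → graph f n y → R n y

Computable : PartialFn → Set
Computable f = Σ (PR 1) λ e → f ⊆ₚ (λ n y → e [ n ∷ [] ]⇓ y)

-- Coding finite sequences of naturals as naturals (bijection List ℕ ≅ ℕ)
--   [] ↦ 0,   a ∷ l ↦ 2^a · (2·code l + 1)

code : List ℕ → ℕ
code []      = 0
code (a ∷ l) = 2 ^ a * (2 * code l + 1)

-- A sequential functional Φ is a partial computable function on codes of
-- finite sequences; its output r codes ⟨i,q⟩ ∈ {0,1}×ω as r = 2q + i,
-- i.e. 2q means "query q" (⟨0,q⟩) and 2q+1 means "halt with output q" (⟨1,q⟩).

-- Runs Φ g n as y : the g-relative sequential computation Φ[g] on input n,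
-- having received oracle answers `as` (in order a₀,…,a_{s-1}), halts with y.
data Runs (Φ : PR 1) (g : PartialFn) (n : ℕ) : List ℕ → ℕ → Set where
  halt  : ∀ {as q} → Φ [ code (n ∷ as) ∷ [] ]⇓ (1 + 2 * q) → Runs Φ g n as q
  query : ∀ {as q a y} → Φ [ code (n ∷ as) ∷ [] ]⇓ (2 * q) →
          graph g q a → Runs Φ g n (as ++ [ a ]) y → Runs Φ g n as y

_⟦_⟧_↦_ : PR 1 → PartialFn → ℕ → ℕ → Set
Φ ⟦ g ⟧ n ↦ y = Runs Φ g n [] y

_≤subT_ : PartialFn → PartialFn → Set
f ≤subT g = Σ (PR 1) λ Φ → f ⊆ₚ (λ n y → Φ ⟦ g ⟧ n ↦ y)

Quasiminimal : PartialFn → Set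
Quasiminimal f = ¬ Computable f × (∀ (g : ℕ → ℕ) → total g ≤subT f → Computable (total g))

{-# OPTIONS --safe #-}
module Submission where

open import Defs
open import Level using (0ℓ)
open import Axiom.ExcludedMiddle using (ExcludedMiddle)
open import Data.Product using (Σ; _×_)
open import Relation.Nullary using (¬_)

open import Function using (_∘_)
open import Data.Product using (∃; ∃₂; _,_; proj₁; proj₂)
open import Data.Sum using (inj₁; inj₂)
open import Data.Empty using (⊥-elim)
open import Relation.Nullary using (yes; no; Dec; contradiction)
open import Relation.Nullary.Decidable using (decidable-stable)
open import Relation.Binary.Definitions using (tri<; tri≈; tri>)
open import Relation.Binary.PropositionalEquality
  using (_≡_; _≢_; refl; sym; trans; cong; cong₂; subst; module ≡-Reasoning)
open import Data.Nat
  using (ℕ; zero; suc; _+_; _*_; _∸_; _^_; _≤_; _<_; z≤n; s≤s; pred; _⊔_; _≟_; ∣_-_∣;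
         NonZero; ≢-nonZero; _≤′_; ≤′-refl; ≤′-step)
open import Data.Nat.Properties
open import Data.Nat.Tactic.RingSolver using (solve-∀)
import Data.Fin as Fin
open import Data.Vec using (Vec; []; _∷_)
open import Data.Vec.Relation.Unary.All using (All; []; _∷_)
import Data.Vec.Relation.Unary.All as All
open import Data.List using (List; []; _∷_; _++_; [_]; map; concatMap; upTo; allFin; cartesianProductWith)
open import Data.List.Relation.Unary.Any using (here; there)
open import Data.List.Membership.Propositional using (_∈_; _∉_; lose)
open import Data.List.Membership.Propositional.Properties
  using (∈-++⁺ˡ; ∈-++⁺ʳ; ∈-map⁺; ∈-concatMap⁺; ∈-cartesianProductWith⁺; ∈-upTo⁺; ∈-allFin)
open import Data.List.Membership.DecPropositional _≟_ using (_∈?_)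
open import Data.List.Relation.Binary.Subset.Propositional using (_⊆_)
open import Data.List.Relation.Binary.Subset.Propositional.Properties using (⊆-refl; ⊆-trans)
open import Data.List.Relation.Binary.Disjoint.Propositional using (Disjoint)

-- h is f restricted to a set D built by finite extension in stages, using
-- excluded middle to decide the existential questions that arise.  At stage i,
-- with Φ the i-th program: if Φ, run with oracle f restricted to the finite part
-- I of D built so far, can ask a question q ∉ I, then q is banned from D forever,
-- so every run of Φ[h] through that question diverges; otherwise Φ[h] and
-- Φ[f ↾ I] agree wherever Φ[h] halts, and f ↾ I is finite, hence computable.
-- Then, with e the i-th program as a candidate for h, some n not banned at
-- which e does not converge to f(n) is put into D; if there is none, f agrees
-- with e outside finitely many points and would be computable.  Finally
-- h ⊆ f, so h ≤subT f via the functional that copies its oracle.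

mutual
  ⇓-functional : ∀ {n} {e : PR n} {xs y y′} → e [ xs ]⇓ y → e [ xs ]⇓ y′ → y ≡ y′
  ⇓-functional ev-zer  ev-zer  = refl
  ⇓-functional ev-succ ev-succ = refl
  ⇓-functional ev-proj ev-proj = refl
  ⇓-functional (ev-comp ds d) (ev-comp ds′ d′) with ⇓*-functional ds ds′
  ... | refl = ⇓-functional d d′
  ⇓-functional (ev-prim-z d) (ev-prim-z d′) = ⇓-functional d d′
  ⇓-functional (ev-prim-s d₁ d₂) (ev-prim-s d₁′ d₂′) with ⇓-functional d₁ d₁′
  ... | refl = ⇓-functional d₂ d₂′
  ⇓-functional (ev-mu {y = y} d below) (ev-mu {y = y′} d′ below′) with <-cmp y y′
  ... | tri≈ _ y≡y′ _ = y≡y′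
  ... | tri< y<y′ _ _ = contradiction (⇓-functional d (proj₂ (below′ y y<y′))) 0≢1+n
  ... | tri> _ _ y>y′ = contradiction (⇓-functional d′ (proj₂ (below y′ y>y′))) 0≢1+n

  ⇓*-functional : ∀ {m n} {es : Vec (PR n) m} {xs ys ys′} →
                  es [ xs ]⇓* ys → es [ xs ]⇓* ys′ → ys ≡ ys′
  ⇓*-functional ev-[]       ev-[]         = refl
  ⇓*-functional (ev-∷ d ds) (ev-∷ d′ ds′) = cong₂ _∷_ (⇓-functional d d′) (⇓*-functional ds ds′)

-- Arithmetic programs

π₀ : ∀ {n} → PR (suc n)
π₀ = proj Fin.zero

π₁ : ∀ {n} → PR (suc (suc n))
π₁ = proj (Fin.suc Fin.zero)

π₂ : ∀ {n} → PR (suc (suc (suc n)))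
π₂ = proj (Fin.suc (Fin.suc Fin.zero))

infixr 9 _·_
_·_ : ∀ {n} → PR 1 → PR n → PR n
f · a = comp f (a ∷ [])

module _ {n} {xs : Vec ℕ n} where

  ·-⇓ : ∀ {f a x y} → a [ xs ]⇓ x → f [ x ∷ [] ]⇓ y → (f · a) [ xs ]⇓ y
  ·-⇓ a⇓ f⇓ = ev-comp (ev-∷ a⇓ ev-[]) f⇓

  comp₂-⇓ : ∀ {f : PR 2} {a b x y z} →
            a [ xs ]⇓ x → b [ xs ]⇓ y → f [ x ∷ y ∷ [] ]⇓ z → comp f (a ∷ b ∷ []) [ xs ]⇓ z
  comp₂-⇓ a⇓ b⇓ f⇓ = ev-comp (ev-∷ a⇓ (ev-∷ b⇓ ev-[])) f⇓

constᴾ : ∀ {n} → ℕ → PR n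
constᴾ zero    = zer
constᴾ (suc k) = succ · constᴾ k

constᴾ-⇓ : ∀ {n} {xs : Vec ℕ n} k → constᴾ k [ xs ]⇓ k
constᴾ-⇓ zero    = ev-zer
constᴾ-⇓ (suc k) = ·-⇓ (constᴾ-⇓ k) ev-succ

addᴾ : PR 2
addᴾ = prim π₀ (succ · π₁)

addᴾ-⇓ : ∀ x y → addᴾ [ x ∷ y ∷ [] ]⇓ (x + y)
addᴾ-⇓ zero    y = ev-prim-z ev-proj
addᴾ-⇓ (suc x) y = ev-prim-s (addᴾ-⇓ x y) (·-⇓ ev-proj ev-succ)

predᴾ : PR 1
predᴾ = prim zer π₀

predᴾ-⇓ : ∀ x → predᴾ [ x ∷ [] ]⇓ pred x
predᴾ-⇓ zero    = ev-prim-z ev-zer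
predᴾ-⇓ (suc x) = ev-prim-s (predᴾ-⇓ x) ev-proj

monusᴾ : PR 2
monusᴾ = prim π₀ (predᴾ · π₁)

monusᴾ-⇓ : ∀ k x → monusᴾ [ k ∷ x ∷ [] ]⇓ (x ∸ k)
monusᴾ-⇓ zero    x = ev-prim-z ev-proj
monusᴾ-⇓ (suc k) x = subst (monusᴾ [ suc k ∷ x ∷ [] ]⇓_) (pred[m∸n]≡m∸[1+n] x k)
  (ev-prim-s (monusᴾ-⇓ k x) (·-⇓ ev-proj (predᴾ-⇓ _)))

infixl 6 _⊕_ _⊖_
infixl 7 _⊗_

_⊕_ _⊖_ : ∀ {n} → PR n → PR n → PR n
a ⊕ b = comp addᴾ (a ∷ b ∷ [])
a ⊖ b = comp monusᴾ (b ∷ a ∷ [])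

mulᴾ : PR 2
mulᴾ = prim zer (π₂ ⊕ π₁)

mulᴾ-⇓ : ∀ x y → mulᴾ [ x ∷ y ∷ [] ]⇓ (x * y)
mulᴾ-⇓ zero    y = ev-prim-z ev-zer
mulᴾ-⇓ (suc x) y = ev-prim-s (mulᴾ-⇓ x y) (comp₂-⇓ ev-proj ev-proj (addᴾ-⇓ y (x * y)))

_⊗_ : ∀ {n} → PR n → PR n → PR n
a ⊗ b = comp mulᴾ (a ∷ b ∷ [])

module _ {n} {xs : Vec ℕ n} {a b : PR n} {x y : ℕ} (a⇓ : a [ xs ]⇓ x) (b⇓ : b [ xs ]⇓ y) where

  ⊕-⇓ : (a ⊕ b) [ xs ]⇓ (x + y)
  ⊕-⇓ = comp₂-⇓ a⇓ b⇓ (addᴾ-⇓ x y)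

  ⊖-⇓ : (a ⊖ b) [ xs ]⇓ (x ∸ y)
  ⊖-⇓ = comp₂-⇓ b⇓ a⇓ (monusᴾ-⇓ y x)

  ⊗-⇓ : (a ⊗ b) [ xs ]⇓ (x * y)
  ⊗-⇓ = comp₂-⇓ a⇓ b⇓ (mulᴾ-⇓ x y)

pow2ᴾ : PR 1
pow2ᴾ = prim (constᴾ 1) (constᴾ 2 ⊗ π₁)

pow2ᴾ-⇓ : ∀ x → pow2ᴾ [ x ∷ [] ]⇓ (2 ^ x)
pow2ᴾ-⇓ zero    = ev-prim-z (constᴾ-⇓ 1)
pow2ᴾ-⇓ (suc x) = ev-prim-s (pow2ᴾ-⇓ x) (⊗-⇓ (constᴾ-⇓ 2) ev-proj)

parity : ℕ → ℕ
parity zero    = 0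
parity (suc k) = 1 ∸ parity k

half : ℕ → ℕ
half zero    = 0
half (suc k) = half k + parity k

parityᴾ : PR 1
parityᴾ = prim zer (constᴾ 1 ⊖ π₁)

parityᴾ-⇓ : ∀ x → parityᴾ [ x ∷ [] ]⇓ parity x
parityᴾ-⇓ zero    = ev-prim-z ev-zer
parityᴾ-⇓ (suc x) = ev-prim-s (parityᴾ-⇓ x) (⊖-⇓ (constᴾ-⇓ 1) ev-proj)

halfᴾ : PR 1
halfᴾ = prim zer (π₁ ⊕ parityᴾ · π₀)

halfᴾ-⇓ : ∀ x → halfᴾ [ x ∷ [] ]⇓ half x
halfᴾ-⇓ zero    = ev-prim-z ev-zer
halfᴾ-⇓ (suc x) = ev-prim-s (halfᴾ-⇓ x) (⊕-⇓ ev-proj (·-⇓ ev-proj (parityᴾ-⇓ x)))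

parity-even : ∀ q → parity (2 * q) ≡ 0
half-even   : ∀ q → half (2 * q) ≡ q

parity-even zero    = refl
parity-even (suc q) = trans (cong parity (*-suc 2 q)) (cong (λ p → 1 ∸ (1 ∸ p)) (parity-even q))

half-even zero    = refl
half-even (suc q) = begin
  half (2 * suc q)                                     ≡⟨ cong half (*-suc 2 q) ⟩
  half (2 * q) + parity (2 * q) + (1 ∸ parity (2 * q))
    ≡⟨ cong₂ (λ h p → h + p + (1 ∸ p)) (half-even q) (parity-even q) ⟩
  q + 0 + 1                                            ≡⟨ cong (_+ 1) (+-identityʳ q) ⟩
  q + 1                                                ≡⟨ +-comm q 1 ⟩
  suc q                                                ∎
  where open ≡-Reasoning

half-odd : ∀ q → half (1 + 2 * q) ≡ q
half-odd q rewrite parity-even q | half-even q = +-identityʳ q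

-- Lazy in v: v is evaluated only when b is nonzero, so it may diverge
-- where b is 0 (u is always evaluated, as the base of the recursion).
ifZeroᴾ : PR 1 → PR 1 → PR 1 → PR 1
ifZeroᴾ b u v = comp (prim u (v · π₂)) (b ∷ π₀ ∷ [])

module _ {b u v : PR 1} {x y : ℕ} where

  ifZeroᴾ-zero : b [ x ∷ [] ]⇓ 0 → u [ x ∷ [] ]⇓ y → ifZeroᴾ b u v [ x ∷ [] ]⇓ y
  ifZeroᴾ-zero b⇓ u⇓ = comp₂-⇓ b⇓ ev-proj (ev-prim-z u⇓)

  ifZeroᴾ-nonZero : ∀ {k z} → u [ x ∷ [] ]⇓ z → b [ x ∷ [] ]⇓ k → .{{NonZero k}} →
                    v [ x ∷ [] ]⇓ y → ifZeroᴾ b u v [ x ∷ [] ]⇓ y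
  ifZeroᴾ-nonZero {suc k} u⇓ b⇓ v⇓ = comp₂-⇓ b⇓ ev-proj (steps k)
    where
    steps : ∀ j → prim u (v · π₂) [ suc j ∷ x ∷ [] ]⇓ y
    steps zero    = ev-prim-s (ev-prim-z u⇓) (·-⇓ ev-proj v⇓)
    steps (suc j) = ev-prim-s (steps j) (·-⇓ ev-proj v⇓)

-- Codes of finite sequences

-- Binary length of code l.
width : List ℕ → ℕ
width []      = 0
width (a ∷ l) = a + suc (width l)

code-∷ʳ : ∀ l a → code (l ++ [ a ]) ≡ code l + 2 ^ (width l + a)
code-∷ʳ []      a = *-identityʳ (2 ^ a)
code-∷ʳ (x ∷ l) a = begin
  2 ^ x * (2 * code (l ++ [ a ]) + 1)            ≡⟨ cong (λ c → 2 ^ x * (2 * c + 1)) (code-∷ʳ l a) ⟩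
  2 ^ x * (2 * (code l + 2 ^ (width l + a)) + 1) ≡⟨ distribute (2 ^ x) (code l) (2 ^ (width l + a)) ⟩
  code (x ∷ l) + 2 ^ x * 2 ^ suc (width l + a)   ≡⟨ cong (code (x ∷ l) +_) (^-distribˡ-+-* 2 x _) ⟨
  code (x ∷ l) + 2 ^ (x + suc (width l + a))
    ≡⟨ cong (λ e → code (x ∷ l) + 2 ^ e) (+-assoc x (suc (width l)) a) ⟨
  code (x ∷ l) + 2 ^ (width (x ∷ l) + a)         ∎
  where
  open ≡-Reasoning
  distribute : ∀ X c P → X * (2 * (c + P) + 1) ≡ X * (2 * c + 1) + X * (2 * P)
  distribute = solve-∀

code<2^width : ∀ l → code l < 2 ^ width l
code<2^width []      = s≤s z≤n
code<2^width (a ∷ l) = begin-strict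
  2 ^ a * (2 * code l + 1)  <⟨ *-monoʳ-< (2 ^ a) {{m^n≢0 2 a}} (2*code+1<2*2^width) ⟩
  2 ^ a * (2 * 2 ^ width l) ≡⟨ ^-distribˡ-+-* 2 a (suc (width l)) ⟨
  2 ^ width (a ∷ l)         ∎
  where
  open ≤-Reasoning
  2*code+1<2*2^width : 2 * code l + 1 < 2 * 2 ^ width l
  2*code+1<2*2^width = subst (_≤ 2 * 2 ^ width l) (double-suc (code l)) (*-monoʳ-≤ 2 (code<2^width l))
    where
    double-suc : ∀ c → 2 * suc c ≡ suc (2 * c + 1)
    double-suc = solve-∀

2^width≤2*code+1 : ∀ l → 2 ^ width l ≤ 2 * code l + 1
2^width≤2*code+1 []      = s≤s z≤n
2^width≤2*code+1 (a ∷ l) = begin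
  2 ^ (a + suc (width l))            ≡⟨ ^-distribˡ-+-* 2 a (suc (width l)) ⟩
  2 ^ a * (2 * 2 ^ width l)          ≤⟨ *-monoʳ-≤ (2 ^ a) (*-monoʳ-≤ 2 (2^width≤2*code+1 l)) ⟩
  2 ^ a * (2 * (2 * code l + 1))     ≡⟨ regroup (2 ^ a) (2 * code l + 1) ⟩
  2 * (2 ^ a * (2 * code l + 1))     ≤⟨ m≤m+n _ 1 ⟩
  2 * (2 ^ a * (2 * code l + 1)) + 1 ∎
  where
  open ≤-Reasoning
  regroup : ∀ X Y → X * (2 * Y) ≡ 2 * (X * Y)
  regroup = solve-∀

2^i≤code : ∀ l {i} → i < width l → 2 ^ i ≤ code l
2^i≤code (a ∷ l) {i} i<width = begin
  2 ^ i                    ≤⟨ ^-monoʳ-≤ 2 i≤a+width ⟩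
  2 ^ (a + width l)        ≡⟨ ^-distribˡ-+-* 2 a (width l) ⟩
  2 ^ a * 2 ^ width l      ≤⟨ *-monoʳ-≤ (2 ^ a) (2^width≤2*code+1 l) ⟩
  2 ^ a * (2 * code l + 1) ∎
  where
  open ≤-Reasoning
  i≤a+width : i ≤ a + width l
  i≤a+width = ≤-pred (subst (i <_) (+-suc a (width l)) i<width)

-- 1 + code l ∸ 2 ^ i vanishes exactly when code l < 2 ^ i, so μ finds width l.
widthSearch : PR 2
widthSearch = succ · π₁ ⊖ pow2ᴾ · π₀

widthᴾ : PR 1
widthᴾ = mu widthSearch

widthᴾ-⇓ : ∀ l → widthᴾ [ code l ∷ [] ]⇓ width l
widthᴾ-⇓ l = ev-mu
  (subst (Search (width l)) (m≤n⇒m∸n≡0 (code<2^width l)) (search-⇓ (width l)))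
  (λ i i<width → code l ∸ 2 ^ i , subst (Search i) (+-∸-assoc 1 (2^i≤code l i<width)) (search-⇓ i))
  where
  Search : ℕ → ℕ → Set
  Search i y = widthSearch [ i ∷ code l ∷ [] ]⇓ y
  search-⇓ : ∀ i → Search i (suc (code l) ∸ 2 ^ i)
  search-⇓ i = ⊖-⇓ (·-⇓ ev-proj ev-succ) (·-⇓ ev-proj (pow2ᴾ-⇓ i))

consᴾ : ∀ {k} → PR k → PR k → PR k
consᴾ a c = pow2ᴾ · a ⊗ (constᴾ 2 ⊗ c ⊕ constᴾ 1)

consᴾ-⇓ : ∀ {k} {xs : Vec ℕ k} {a c n as} →
          a [ xs ]⇓ n → c [ xs ]⇓ code as → consᴾ a c [ xs ]⇓ code (n ∷ as)
consᴾ-⇓ a⇓ c⇓ = ⊗-⇓ (·-⇓ a⇓ (pow2ᴾ-⇓ _)) (⊕-⇓ (⊗-⇓ (constᴾ-⇓ 2) c⇓) (constᴾ-⇓ 1))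

-- Relative computation

data Reaches (Φ : PR 1) (g : PartialFn) (n : ℕ) : List ℕ → Set where
  start  : Reaches Φ g n []
  answer : ∀ {as q a} → Reaches Φ g n as → Φ [ code (n ∷ as) ∷ [] ]⇓ (2 * q) → graph g q a →
           Reaches Φ g n (as ++ [ a ])

Asks : PR 1 → PartialFn → ℕ → Set
Asks Φ g q = ∃₂ λ n as → Reaches Φ g n as × Φ [ code (n ∷ as) ∷ [] ]⇓ (2 * q)

module _ {Φ : PR 1} {n : ℕ} where

  Reaches-mono : ∀ {g g′ as} → g ⊆ₚ graph g′ → Reaches Φ g n as → Reaches Φ g′ n as
  Reaches-mono g⊆g′ start           = start
  Reaches-mono g⊆g′ (answer r d ga) = answer (Reaches-mono g⊆g′ r) d (g⊆g′ _ _ ga)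

  Runs-query : ∀ {g as q y} → Runs Φ g n as y → Φ [ code (n ∷ as) ∷ [] ]⇓ (2 * q) →
               ∃ λ a → graph g q a × Runs Φ g n (as ++ [ a ]) y
  Runs-query {q = q} (halt {q = y} d′) d = contradiction (⇓-functional d d′) (even≢odd q y)
  Runs-query {q = q} (query {q = q′} d′ ga R) d with *-cancelˡ-≡ q q′ 2 (⇓-functional d d′)
  ... | refl = _ , ga , R

  Runs-through : ∀ {g as y} → Reaches Φ g n as → Runs Φ g n [] y → Runs Φ g n as y
  Runs-through start R = R
  Runs-through {g} {y = y} (answer {as} r d ga) R with Runs-query (Runs-through r R) d
  ... | _ , ga′ , R′ = subst (λ a → Runs Φ g n (as ++ [ a ]) y) (functional g ga′ ga) R′

  Runs-transfer : ∀ {g g₀ as y} → (∀ {q a} → Asks Φ g₀ q → graph g q a → graph g₀ q a) →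
                  Reaches Φ g₀ n as → Runs Φ g n as y → Runs Φ g₀ n as y
  Runs-transfer agree r (halt d)       = halt d
  Runs-transfer agree r (query d ga R) = query d ga₀ (Runs-transfer agree (answer r d ga₀) R)
    where ga₀ = agree (n , _ , r , d) ga

Asks-answered : ∀ {Φ g₀ g q} → g₀ ⊆ₚ graph g → (∀ n → ∃ λ y → Runs Φ g n [] y) →
                Asks Φ g₀ q → ∃ λ a → graph g q a
Asks-answered g₀⊆g halts (n , as , r , d) =
  let a , gqa , _ = Runs-query (Runs-through (Reaches-mono g₀⊆g r) (proj₂ (halts n))) d in a , gqa

-- answers [ t ∷ n ∷ [] ] is the code of the first t oracle answers in the
-- run of Φ on input n, as long as Φ is still querying; sim runs Φ on the
-- answers collected up to the first t at which Φ halts.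
module Simulation (Φ oracle : PR 1) where

  extend : PR 3
  extend = π₁ ⊕ pow2ᴾ · (widthᴾ · π₁ ⊕ oracle · halfᴾ · Φ · consᴾ π₂ π₁)

  answers : PR 2
  answers = prim zer extend

  querying : PR 2
  querying = parityᴾ · succ · Φ · consᴾ π₁ answers

  sim : PR 1
  sim = halfᴾ · Φ · consᴾ π₀ (comp answers (mu querying ∷ π₀ ∷ []))

  module _ {g : PartialFn} (g⊆oracle : g ⊆ₚ (λ q a → oracle [ q ∷ [] ]⇓ a)) (n : ℕ) where

    querying-⇓ : ∀ {t as r} → answers [ t ∷ n ∷ [] ]⇓ code as → Φ [ code (n ∷ as) ∷ [] ]⇓ r →
                 querying [ t ∷ n ∷ [] ]⇓ parity (suc r)
    querying-⇓ {as = as} answers⇓ Φ⇓ =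
      ·-⇓ (·-⇓ (·-⇓ (consᴾ-⇓ {as = as} ev-proj answers⇓) Φ⇓) ev-succ) (parityᴾ-⇓ _)

    sim-from : ∀ {as y} t → Runs Φ g n as y → answers [ t ∷ n ∷ [] ]⇓ code as →
               (∀ i → i < t → ∃ λ k → querying [ i ∷ n ∷ [] ]⇓ suc k) → sim [ n ∷ [] ]⇓ y
    sim-from {as} t (halt {q = y} d) answers⇓ querying-before =
      subst (sim [ n ∷ [] ]⇓_) (half-odd y)
        (·-⇓ (·-⇓ (consᴾ-⇓ {as = as} ev-proj answers-at-halt⇓) d) (halfᴾ-⇓ _))
      where
      halts : querying [ t ∷ n ∷ [] ]⇓ 0
      halts = subst (querying [ t ∷ n ∷ [] ]⇓_) (cong (λ p → 1 ∸ (1 ∸ p)) (parity-even y))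
        (querying-⇓ {as = as} answers⇓ d)
      answers-at-halt⇓ : comp answers (mu querying ∷ π₀ ∷ []) [ n ∷ [] ]⇓ code as
      answers-at-halt⇓ = comp₂-⇓ (ev-mu halts querying-before) ev-proj answers⇓
    sim-from {as} t (query {q = q} {a} d ga R) answers⇓ querying-before =
      sim-from (suc t) R answers⇓′ querying-before′
      where
      asks : querying [ t ∷ n ∷ [] ]⇓ 1
      asks = subst (querying [ t ∷ n ∷ [] ]⇓_) (cong (1 ∸_) (parity-even q))
        (querying-⇓ {as = as} answers⇓ d)
      query⇓ : (halfᴾ · Φ · consᴾ π₂ π₁) [ t ∷ code as ∷ n ∷ [] ]⇓ q
      query⇓ = subst (_ [ t ∷ code as ∷ n ∷ [] ]⇓_) (half-even q)
        (·-⇓ (·-⇓ (consᴾ-⇓ {as = as} ev-proj ev-proj) d) (halfᴾ-⇓ _))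
      extend⇓ : extend [ t ∷ code as ∷ n ∷ [] ]⇓ (code as + 2 ^ (width as + a))
      extend⇓ =
        ⊕-⇓ ev-proj (·-⇓ (⊕-⇓ (·-⇓ ev-proj (widthᴾ-⇓ as)) (·-⇓ query⇓ (g⊆oracle q a ga)))
                         (pow2ᴾ-⇓ _))
      answers⇓′ : answers [ suc t ∷ n ∷ [] ]⇓ code (as ++ [ a ])
      answers⇓′ = subst (answers [ suc t ∷ n ∷ [] ]⇓_) (sym (code-∷ʳ as a))
        (ev-prim-s answers⇓ extend⇓)
      querying-before′ : ∀ i → i < suc t → ∃ λ k → querying [ i ∷ n ∷ [] ]⇓ suc k
      querying-before′ i i<1+t with m≤n⇒m<n∨m≡n (≤-pred i<1+t)
      ... | inj₁ i<t  = querying-before i i<t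
      ... | inj₂ refl = 0 , asks

    sim-correct : ∀ {y} → Runs Φ g n [] y → sim [ n ∷ [] ]⇓ y
    sim-correct R = sim-from 0 R (ev-prim-z ev-zer) (λ _ ())

≤subT-computable : ∀ {f g} → f ≤subT g → Computable g → Computable f
≤subT-computable (Φ , f⊆Φ[g]) (e , g⊆e) =
  Simulation.sim Φ e , λ n y fny → Simulation.sim-correct Φ e g⊆e n (f⊆Φ[g] n y fny)

-- On code (n ∷ []) = 2 ^ n the copy functional asks n; on
-- code (n ∷ a ∷ []) = 2 ^ (n + suc a) + 2 ^ n it halts with a.  The two
-- cases are told apart by rest = c ∸ 2 ^ (width c ∸ 1), which is 0 resp. 2 ^ n.
module Copy where

  top rest output : PR 1
  top    = widthᴾ · π₀ ⊖ constᴾ 1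
  rest   = π₀ ⊖ pow2ᴾ · top
  output = widthᴾ · π₀ ⊖ (widthᴾ · rest ⊕ constᴾ 1)

  Φ : PR 1
  Φ = ifZeroᴾ rest (constᴾ 2 ⊗ top) (constᴾ 1 ⊕ constᴾ 2 ⊗ output)

  top-⇓ : ∀ l → top [ code l ∷ [] ]⇓ (width l ∸ 1)
  top-⇓ l = ⊖-⇓ (·-⇓ ev-proj (widthᴾ-⇓ l)) (constᴾ-⇓ 1)

  rest-⇓ : ∀ l → rest [ code l ∷ [] ]⇓ (code l ∸ 2 ^ (width l ∸ 1))
  rest-⇓ l = ⊖-⇓ ev-proj (·-⇓ (top-⇓ l) (pow2ᴾ-⇓ _))

  asks-input : ∀ n → Φ [ code (n ∷ []) ∷ [] ]⇓ (2 * n)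
  asks-input n = ifZeroᴾ-zero rest⇓ (⊗-⇓ (constᴾ-⇓ 2) top⇓)
    where
    top⇓ : top [ code (n ∷ []) ∷ [] ]⇓ n
    top⇓ = subst (top [ code (n ∷ []) ∷ [] ]⇓_) (m+n∸n≡m n 1) (top-⇓ (n ∷ []))
    rest≡0 : 2 ^ n * 1 ∸ 2 ^ (n + 1 ∸ 1) ≡ 0
    rest≡0 rewrite m+n∸n≡m n 1 | *-identityʳ (2 ^ n) = n∸n≡0 (2 ^ n)
    rest⇓ : rest [ code (n ∷ []) ∷ [] ]⇓ 0
    rest⇓ = subst (rest [ code (n ∷ []) ∷ [] ]⇓_) rest≡0 (rest-⇓ (n ∷ []))

  returns-answer : ∀ n a → Φ [ code (n ∷ a ∷ []) ∷ [] ]⇓ (1 + 2 * a)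
  returns-answer n a = ifZeroᴾ-nonZero (⊗-⇓ (constᴾ-⇓ 2) (top-⇓ (n ∷ a ∷ []))) rest⇓ {{2^n*1≢0}}
                                       (⊕-⇓ (constᴾ-⇓ 1) (⊗-⇓ (constᴾ-⇓ 2) output⇓))
    where
    open ≡-Reasoning
    c = code (n ∷ a ∷ [])
    2^n*1≢0 : NonZero (2 ^ n * 1)
    2^n*1≢0 = m*n≢0 (2 ^ n) 1 {{m^n≢0 2 n}}
    c≡2^top+2^n : c ≡ 2 ^ (n + suc a) + 2 ^ n * 1
    c≡2^top+2^n = trans (split (2 ^ n) (2 ^ a)) (sym (cong (_+ 2 ^ n * 1) (^-distribˡ-+-* 2 n (suc a))))
      where
      split : ∀ X Y → X * (2 * (Y * 1) + 1) ≡ X * (2 * Y) + X * 1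
      split = solve-∀
    rest≡ : c ∸ 2 ^ (n + suc (a + 1) ∸ 1) ≡ 2 ^ n * 1
    rest≡ = begin
      c ∸ 2 ^ (n + suc (a + 1) ∸ 1)                 ≡⟨ cong (λ e → c ∸ 2 ^ (e ∸ 1)) (+-suc n (a + 1)) ⟩
      c ∸ 2 ^ (n + (a + 1))                         ≡⟨ cong (λ e → c ∸ 2 ^ (n + e)) (+-comm a 1) ⟩
      c ∸ 2 ^ (n + suc a)                           ≡⟨ cong (_∸ 2 ^ (n + suc a)) c≡2^top+2^n ⟩
      2 ^ (n + suc a) + 2 ^ n * 1 ∸ 2 ^ (n + suc a) ≡⟨ m+n∸m≡n (2 ^ (n + suc a)) (2 ^ n * 1) ⟩
      2 ^ n * 1                                     ∎
    rest⇓ : rest [ c ∷ [] ]⇓ code (n ∷ [])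
    rest⇓ = subst (rest [ c ∷ [] ]⇓_) rest≡ (rest-⇓ (n ∷ a ∷ []))
    width-difference : n + suc (a + 1) ∸ (n + 1 + 1) ≡ a
    width-difference = trans (cong (_∸ (n + 1 + 1)) (regroup n a)) (m+n∸m≡n (n + 1 + 1) a)
      where
      regroup : ∀ n a → n + suc (a + 1) ≡ n + 1 + 1 + a
      regroup = solve-∀
    output⇓ : output [ c ∷ [] ]⇓ a
    output⇓ = subst (output [ c ∷ [] ]⇓_) width-difference
      (⊖-⇓ (·-⇓ ev-proj (widthᴾ-⇓ (n ∷ a ∷ [])))
           (⊕-⇓ (·-⇓ rest⇓ (widthᴾ-⇓ (n ∷ []))) (constᴾ-⇓ 1)))

⊆⇒≤subT : ∀ {h f} → h ⊆ₚ graph f → h ≤subT f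
⊆⇒≤subT h⊆f =
  Copy.Φ , λ n a hna → query (Copy.asks-input n) (h⊆f n a hna) (halt (Copy.returns-answer n a))

-- Finite modifications

∸+∸≡∣-∣ : ∀ m n → m ∸ n + (n ∸ m) ≡ ∣ m - n ∣
∸+∸≡∣-∣ zero    zero    = refl
∸+∸≡∣-∣ zero    (suc n) = refl
∸+∸≡∣-∣ (suc m) zero    = +-identityʳ (suc m)
∸+∸≡∣-∣ (suc m) (suc n) = ∸+∸≡∣-∣ m n

distanceᴾ : ℕ → PR 1
distanceᴾ o = π₀ ⊖ constᴾ o ⊕ (constᴾ o ⊖ π₀)

distanceᴾ-⇓ : ∀ o x → distanceᴾ o [ x ∷ [] ]⇓ ∣ x - o ∣
distanceᴾ-⇓ o x = subst (distanceᴾ o [ x ∷ [] ]⇓_) (∸+∸≡∣-∣ x o)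
  (⊕-⇓ (⊖-⇓ ev-proj (constᴾ-⇓ o)) (⊖-⇓ (constᴾ-⇓ o) ev-proj))

patchᴾ : PR 1 → ℕ → ℕ → PR 1
patchᴾ e o v = ifZeroᴾ (distanceᴾ o) (constᴾ v) e

patchᴾ-at : ∀ e o v → patchᴾ e o v [ o ∷ [] ]⇓ v
patchᴾ-at e o v =
  ifZeroᴾ-zero (subst (distanceᴾ o [ o ∷ [] ]⇓_) (∣n-n∣≡0 o) (distanceᴾ-⇓ o o)) (constᴾ-⇓ v)

patchᴾ-off : ∀ {e o v x y} → x ≢ o → e [ x ∷ [] ]⇓ y → patchᴾ e o v [ x ∷ [] ]⇓ y
patchᴾ-off {o = o} {v} {x} x≢o e⇓ =
  ifZeroᴾ-nonZero (constᴾ-⇓ v) (distanceᴾ-⇓ o x) {{≢-nonZero (x≢o ∘ ∣m-n∣≡0⇒m≡n)}} e⇓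

computable-modulo-finite : ExcludedMiddle 0ℓ → ∀ f (O : List ℕ) e →
                           (∀ n y → graph f n y → n ∉ O → e [ n ∷ [] ]⇓ y) → Computable f
computable-modulo-finite lem f []      e agree = e , λ n y fny → agree n y fny λ ()
computable-modulo-finite lem f (o ∷ O) e agree with lem {∃ (graph f o)}
... | yes (v , fov) = computable-modulo-finite lem f O (patchᴾ e o v) agree′
  where
  agree′ : ∀ n y → graph f n y → n ∉ O → patchᴾ e o v [ n ∷ [] ]⇓ y
  agree′ n y fny n∉O with n ≟ o
  ... | yes refl = subst (patchᴾ e o v [ o ∷ [] ]⇓_) (functional f fov fny) (patchᴾ-at e o v)
  ... | no n≢o   =
    patchᴾ-off n≢o (agree n y fny λ { (here n≡o) → n≢o n≡o ; (there n∈O) → n∉O n∈O })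
... | no o∉dom = computable-modulo-finite lem f O e λ n y fny n∉O →
  agree n y fny λ { (here refl) → o∉dom (y , fny) ; (there n∈O) → n∉O n∈O }

_↾_ : PartialFn → (ℕ → Set) → PartialFn
f ↾ P = record
  { graph      = λ n y → P n × graph f n y
  ; functional = λ p p′ → functional f (proj₂ p) (proj₂ p′)
  }

↾-⊆ : ∀ f P → (f ↾ P) ⊆ₚ graph f
↾-⊆ f P n y = proj₂

↾-finite-computable : ExcludedMiddle 0ℓ → ∀ f (I : List ℕ) → Computable (f ↾ (_∈ I))
↾-finite-computable lem f I =
  computable-modulo-finite lem (f ↾ (_∈ I)) I zer λ n y (n∈I , _) n∉I → contradiction n∈I n∉I

-- An enumeration of programs

vectors : ∀ {A : Set} m → List A → List (Vec A m)
vectors zero    xs = [ [] ]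
vectors (suc m) xs = cartesianProductWith _∷_ xs (vectors m xs)

∈-vectors : ∀ {A : Set} {xs : List A} {m} {v : Vec A m} → All (_∈ xs) v → v ∈ vectors m xs
∈-vectors []        = here refl
∈-vectors (x∈ ∷ v∈) = ∈-cartesianProductWith⁺ _∷_ x∈ (∈-vectors v∈)

successors : (n : ℕ) → List (PR n)
successors 1 = [ succ ]
successors _ = []

mutual
  programs : ℕ → (n : ℕ) → List (PR n)
  programs zero    n = []
  programs (suc k) n = programs k n ++ newPrograms k n

  newPrograms : ℕ → (n : ℕ) → List (PR n)
  newPrograms k n = zer ∷ successors n ++ map proj (allFin n) ++ compositions k n ++ recursions k n
                    ++ map mu (programs k (suc n))

  compositions : ℕ → (n : ℕ) → List (PR n)
  compositions k n =
    concatMap (λ m → cartesianProductWith comp (programs k m) (vectors m (programs k n))) (upTo (suc k))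

  recursions : ℕ → (n : ℕ) → List (PR n)
  recursions k zero    = []
  recursions k (suc n) = cartesianProductWith prim (programs k n) (programs k (suc (suc n)))

programs-mono : ∀ {k k′ n} {t : PR n} → k ≤ k′ → t ∈ programs k n → t ∈ programs k′ n
programs-mono k≤k′ = go (≤⇒≤′ k≤k′)
  where
  go : ∀ {k k′ n} {t : PR n} → k ≤′ k′ → t ∈ programs k n → t ∈ programs k′ n
  go ≤′-refl             t∈ = t∈
  go (≤′-step k≤′k′) t∈ = ∈-++⁺ˡ (go k≤′k′ t∈)

new∈programs : ∀ {k n} {t : PR n} → t ∈ newPrograms k n → t ∈ programs (suc k) n
new∈programs {k} {n} = ∈-++⁺ʳ (programs k n)

mutual
  programs-complete : ∀ {n} (t : PR n) → ∃ λ k → t ∈ programs k n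
  programs-complete zer  = 1 , new∈programs {0} (here refl)
  programs-complete succ = 1 , new∈programs {0} (there (here refl))
  programs-complete {n} (proj i) =
    1 , new∈programs {0} (there (∈-++⁺ʳ (successors n) (∈-++⁺ˡ (∈-map⁺ proj (∈-allFin i)))))
  programs-complete {n} (comp {m} f gs) with programs-complete f | all-programs-complete gs
  ... | k₁ , f∈ | k₂ , gs∈ = suc K , new∈programs {K}
        (there (∈-++⁺ʳ (successors n) (∈-++⁺ʳ (map proj (allFin n)) (∈-++⁺ˡ comp∈))))
    where
    K = m ⊔ k₁ ⊔ k₂
    comp∈ : comp f gs ∈ compositions K n
    comp∈ = ∈-concatMap⁺ _ (lose (∈-upTo⁺ (s≤s (≤-trans (m≤m⊔n m k₁) (m≤m⊔n _ k₂))))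
      (∈-cartesianProductWith⁺ comp (programs-mono (≤-trans (m≤n⊔m m k₁) (m≤m⊔n _ k₂)) f∈)
                                    (∈-vectors (All.map (programs-mono (m≤n⊔m (m ⊔ k₁) k₂)) gs∈))))
  programs-complete {suc n} (prim g h) with programs-complete g | programs-complete h
  ... | k₁ , g∈ | k₂ , h∈ = suc (k₁ ⊔ k₂) , new∈programs {k₁ ⊔ k₂}
        (there (∈-++⁺ʳ (successors (suc n)) (∈-++⁺ʳ (map proj (allFin (suc n)))
          (∈-++⁺ʳ (compositions (k₁ ⊔ k₂) (suc n)) (∈-++⁺ˡ
            (∈-cartesianProductWith⁺ prim (programs-mono (m≤m⊔n k₁ k₂) g∈)
                                          (programs-mono (m≤n⊔m k₁ k₂) h∈)))))))
  programs-complete {n} (mu t) with programs-complete t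
  ... | k , t∈ = suc k , new∈programs {k}
        (there (∈-++⁺ʳ (successors n) (∈-++⁺ʳ (map proj (allFin n))
          (∈-++⁺ʳ (compositions k n) (∈-++⁺ʳ (recursions k n) (∈-map⁺ mu t∈))))))

  all-programs-complete : ∀ {n m} (ts : Vec (PR n) m) → ∃ λ k → All (_∈ programs k n) ts
  all-programs-complete []       = 0 , []
  all-programs-complete (t ∷ ts) with programs-complete t | all-programs-complete ts
  ... | k₁ , t∈ | k₂ , ts∈ =
    k₁ ⊔ k₂ , programs-mono (m≤m⊔n k₁ k₂) t∈ ∷ All.map (programs-mono (m≤n⊔m k₁ k₂)) ts∈

nextPair : ℕ × ℕ → ℕ × ℕ
nextPair (zero  , b) = suc b , 0
nextPair (suc a , b) = a , suc b

unpair : ℕ → ℕ × ℕ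
unpair zero    = 0 , 0
unpair (suc i) = nextPair (unpair i)

Unpaired : ℕ × ℕ → Set
Unpaired p = ∃ λ i → unpair i ≡ p

unpaired-next : ∀ {p} → Unpaired p → Unpaired (nextPair p)
unpaired-next (i , refl) = suc i , refl

unpaired-along-diagonal : ∀ a b → Unpaired (a + b , 0) → Unpaired (a , b)
unpaired-along-diagonal a zero    u = subst (λ c → Unpaired (c , 0)) (+-identityʳ a) u
unpaired-along-diagonal a (suc b) u =
  unpaired-next (unpaired-along-diagonal (suc a) b (subst (λ c → Unpaired (c , 0)) (+-suc a b) u))

unpaired-diagonal-start : ∀ d → Unpaired (d , 0)
unpaired-diagonal-start zero    = 0 , refl
unpaired-diagonal-start (suc d) = unpaired-next (unpaired-along-diagonal 0 d (unpaired-diagonal-start d))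

unpair-surjective : ∀ a b → Unpaired (a , b)
unpair-surjective a b = unpaired-along-diagonal a b (unpaired-diagonal-start (a + b))

nth : ∀ {A : Set} → A → List A → ℕ → A
nth d []       j       = d
nth d (x ∷ xs) zero    = x
nth d (x ∷ xs) (suc j) = nth d xs j

∈⇒nth : ∀ {A : Set} {x : A} {xs} d → x ∈ xs → ∃ λ j → nth d xs j ≡ x
∈⇒nth d (here refl) = 0 , refl
∈⇒nth d (there x∈)  = let j , nth≡x = ∈⇒nth d x∈ in suc j , nth≡x

programAt : ℕ × ℕ → PR 1
programAt (k , j) = nth zer (programs k 1) j

program : ℕ → PR 1
program = programAt ∘ unpair

program-surjective : ∀ t → ∃ λ i → program i ≡ t
program-surjective t with programs-complete t
... | k , t∈ with ∈⇒nth zer t∈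
... | j , nth≡t with unpair-surjective k j
... | i , unpair≡ = i , trans (cong programAt unpair≡) nth≡t

-- The construction

-- inside lists arguments promised to dom h, outside those promised to lie
-- outside it.
record Stage : Set where
  field
    inside  : List ℕ
    outside : List ℕ
open Stage

_⊑_ : Stage → Stage → Set
s ⊑ t = inside s ⊆ inside t × outside s ⊆ outside t

⊑-refl : ∀ {s} → s ⊑ s
⊑-refl = ⊆-refl , ⊆-refl

⊑-trans : ∀ {s t u} → s ⊑ t → t ⊑ u → s ⊑ u
⊑-trans (i₁ , o₁) (i₂ , o₂) = ⊆-trans i₁ i₂ , ⊆-trans o₁ o₂

Separated : Stage → Set
Separated s = Disjoint (inside s) (outside s)

module Construction (lem : ExcludedMiddle 0ℓ) (f : PartialFn) where

  Escapes : PR 1 → List ℕ → Set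
  Escapes Φ I = ∃ λ q → q ∉ I × Asks Φ (f ↾ (_∈ I)) q

  Refuted : PR 1 → List ℕ → Set
  Refuted e O = ∃₂ λ n y → n ∉ O × graph f n y × ¬ e [ n ∷ [] ]⇓ y

  ban : ∀ Φ s → Dec (Escapes Φ (inside s)) → Stage
  ban Φ s (yes (q , _)) = record s { outside = q ∷ outside s }
  ban Φ s (no _)        = s

  admit : ∀ e s → Dec (Refuted e (outside s)) → Stage
  admit e s (yes (n , _)) = record s { inside = n ∷ inside s }
  admit e s (no _)        = s

  ban-⊑ : ∀ Φ s d → s ⊑ ban Φ s d
  ban-⊑ Φ s (yes _) = ⊆-refl , there
  ban-⊑ Φ s (no _)  = ⊑-refl

  admit-⊑ : ∀ e s d → s ⊑ admit e s d
  admit-⊑ e s (yes _) = there , ⊆-refl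
  admit-⊑ e s (no _)  = ⊑-refl

  ban-separated : ∀ Φ s d → Separated s → Separated (ban Φ s d)
  ban-separated Φ s (yes (q , q∉I , _)) sep (q∈I , here refl)   = q∉I q∈I
  ban-separated Φ s (yes _)             sep (v∈I , there v∈O)   = sep (v∈I , v∈O)
  ban-separated Φ s (no _)              sep                     = sep

  admit-separated : ∀ e s d → Separated s → Separated (admit e s d)
  admit-separated e s (yes (n , y , n∉O , _)) sep (here refl , n∈O) = n∉O n∈O
  admit-separated e s (yes _)                 sep (there v∈I , v∈O) = sep (v∈I , v∈O)
  admit-separated e s (no _)                  sep                   = sep

  ban-banned : ∀ Φ s d → Escapes Φ (inside s) →
               ∃ λ q → q ∈ outside (ban Φ s d) × Asks Φ (f ↾ (_∈ inside s)) q
  ban-banned Φ s (yes (q , _ , asks)) _ = q , here refl , asks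
  ban-banned Φ s (no ¬escape) escape    = contradiction escape ¬escape

  admit-admitted : ∀ e s d → Refuted e (outside s) →
                   ∃₂ λ n y → n ∈ inside (admit e s d) × graph f n y × ¬ e [ n ∷ [] ]⇓ y
  admit-admitted e s (yes (n , y , _ , fny , ¬e⇓)) _ = n , y , here refl , fny , ¬e⇓
  admit-admitted e s (no ¬refuted) refuted          = contradiction refuted ¬refuted

  mutual
    stage : ℕ → Stage
    stage zero    = record { inside = [] ; outside = [] }
    stage (suc i) = admit (program i) (midstage i) lem

    midstage : ℕ → Stage
    midstage i = ban (program i) (stage i) lem

  stage-step : ∀ i → stage i ⊑ stage (suc i)
  stage-step i = ⊑-trans (ban-⊑ (program i) (stage i) lem) (admit-⊑ (program i) (midstage i) lem)

  stage-mono : ∀ {i j} → i ≤ j → stage i ⊑ stage j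
  stage-mono i≤j = go (≤⇒≤′ i≤j)
    where
    go : ∀ {i j} → i ≤′ j → stage i ⊑ stage j
    go ≤′-refl         = ⊑-refl
    go (≤′-step {j} i≤′j) = ⊑-trans (go i≤′j) (stage-step j)

  stage-separated : ∀ i → Separated (stage i)
  stage-separated zero    ()
  stage-separated (suc i) = admit-separated (program i) (midstage i) lem
                              (ban-separated (program i) (stage i) lem (stage-separated i))

  inside-outside-disjoint : ∀ {n} i j → n ∈ inside (stage i) → n ∉ outside (stage j)
  inside-outside-disjoint i j n∈I n∈O =
    stage-separated (i ⊔ j)
      (proj₁ (stage-mono (m≤m⊔n i j)) n∈I , proj₂ (stage-mono (m≤n⊔m i j)) n∈O)

  InDomain : ℕ → Set
  InDomain n = ∃ λ i → n ∈ inside (stage i)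

  h : PartialFn
  h = f ↾ InDomain

  h-noncomputable : ¬ Computable f → ¬ Computable h
  h-noncomputable f-nc (e , h⊆e) with program-surjective e
  ... | i , refl with lem {Refuted e (outside (midstage i))}
  ... | yes refuted =
    let n , y , n∈I , fny , ¬e⇓ = admit-admitted e (midstage i) lem refuted
    in ¬e⇓ (h⊆e n y ((suc i , n∈I) , fny))
  ... | no ¬refuted = f-nc (computable-modulo-finite lem f (outside (midstage i)) e λ n y fny n∉O →
    decidable-stable lem λ ¬e⇓ → ¬refuted (n , y , n∉O , fny , ¬e⇓))

  Runs-confined : ∀ {Φ I g n y} → g ⊆ₚ graph f → ¬ Escapes Φ I →
                  Runs Φ g n [] y → Runs Φ (f ↾ (_∈ I)) n [] y
  Runs-confined {Φ} {I} {g} g⊆f ¬escape = Runs-transfer agree start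
    where
    agree : ∀ {q a} → Asks Φ (f ↾ (_∈ I)) q → graph g q a → graph (f ↾ (_∈ I)) q a
    agree {q} asks gqa = decidable-stable (q ∈? I) (λ q∉I → ¬escape (q , q∉I , asks)) , g⊆f _ _ gqa

  escaping-diverges : ∀ i → Escapes (program i) (inside (stage i)) →
                      ¬ (∀ n → ∃ λ y → Runs (program i) h n [] y)
  escaping-diverges i escape halts =
    let q , q∈O , asks = ban-banned (program i) (stage i) lem escape
        _ , (j , q∈I) , _ = Asks-answered (λ q a (q∈I , fqa) → (i , q∈I) , fqa) halts asks
    in inside-outside-disjoint j (suc i) q∈I (proj₂ (admit-⊑ (program i) (midstage i) lem) q∈O)

  total-below-h-computable : ∀ g → total g ≤subT h → Computable (total g)
  total-below-h-computable g (Φ , g⊆Φ[h]) with program-surjective Φ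
  ... | i , refl with lem {Escapes Φ (inside (stage i))}
  ... | yes escape = ⊥-elim (escaping-diverges i escape λ n → g n , g⊆Φ[h] n (g n) refl)
  ... | no ¬escape = ≤subT-computable {total g}
    (Φ , λ n y gny → Runs-confined (↾-⊆ f InDomain) ¬escape (g⊆Φ[h] n y gny))
    (↾-finite-computable lem f (inside (stage i)))

proposition4p3 : ExcludedMiddle 0ℓ →
    ∀ (f : PartialFn) → ¬ Computable f →
    Σ PartialFn (λ h → Quasiminimal h × h ≤subT f)
proposition4p3 lem f f-nc =
  h , (h-noncomputable f-nc , total-below-h-computable) , ⊆⇒≤subT {h} {f} (↾-⊆ f InDomain)
  where open Construction lem f
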